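{- Let $x$ be a string of length $n$ over an alphabet of size $\sigma>1$ whose letters are independent and uniformly distributed over the alphabet, and let $k$ be an integer with $1\le k\le \frac{\log n}{\log\log n}$. Then: (a) the expected value of $\max_{0\le i<j\le n-1}\textsf{lcp}_k(x[i\mathinner{.\,.} n-1],x[j\mathinner{.\,.} n-1])$ is $\mathcal{O}(\log_\sigma n)$; (b) there exists a constant $\alpha$ such that the expected number of pairs $i<j$ with $\textsf{lcp}_k(x[i\mathinner{.\,.} n-1],x[j\mathinner{.\,.} n-1])\ge \alpha\log_\sigma n$ is $\mathcal{O}(1)$.
   Context: $x[i\mathinner{.\,.} j]$ denotes the substring $x[i]\cdots x[j]$. For strings $y,z$, $\textsf{lcp}_k(y,z)$ is the largest $\ell\ge 0$ such that $y[0\mathinner{.\,.}\ell-1]$ and $z[0\mathinner{.\,.}\ell-1]$ exist and are at Hamming distance at most $k$ (the number of positions where they differ). -}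

module Defs where

open import Data.Nat using (ℕ; zero; suc; _+_; _*_; _∸_; _^_; _≤ᵇ_; _⊔_)
open import Data.Bool using (Bool; true; false; if_then_else_; _∧_)
open import Data.Fin using (Fin)
open import Data.Fin.Properties using (_≟_)
open import Data.List using (List; []; _∷_; length; take; drop; map; concatMap; upTo; allFin; foldr)
open import Data.Nat.ListAction using (sum)
open import Data.Product using (_×_; _,_)
open import Relation.Nullary.Decidable using (⌊_⌋)

-- Hamming distance of two lists (compared position-wise; used only on
-- lists of equal length).
ham : ∀ {σ} → List (Fin σ) → List (Fin σ) → ℕ
ham (a ∷ as) (b ∷ bs) = (if ⌊ a ≟ b ⌋ then 0 else 1) + ham as bs
ham _ _ = 0

lcpOK : ∀ {σ} → ℕ → List (Fin σ) → List (Fin σ) → ℕ → Bool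
lcpOK k y z ℓ = (ℓ ≤ᵇ length y) ∧ ((ℓ ≤ᵇ length z) ∧ (ham (take ℓ y) (take ℓ z) ≤ᵇ k))

maxSat : (ℕ → Bool) → ℕ → ℕ
maxSat P zero = 0
maxSat P (suc m) = if P (suc m) then suc m else maxSat P m

lcpK : ∀ {σ} → ℕ → List (Fin σ) → List (Fin σ) → ℕ
lcpK k y z = maxSat (lcpOK k y z) (length y)

pairs : ℕ → List (ℕ × ℕ)
pairs n = concatMap (λ j → map (λ i → (i , j)) (upTo j)) (upTo n)

suffLcp : ∀ {σ} → ℕ → List (Fin σ) → ℕ × ℕ → ℕ
suffLcp k x (i , j) = lcpK k (drop i x) (drop j x)

maxLcp : ∀ {σ} → ℕ → ℕ → List (Fin σ) → ℕ
maxLcp n k x = foldr _⊔_ 0 (map (suffLcp k x) (pairs n))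

-- number of pairs i < j with lcp_k(x[i..], x[j..]) ≥ α log_σ n,
-- the inequality ℓ ≥ α log_σ n being written exactly as n ^ α ≤ σ ^ ℓ.
countLong : ∀ {σ} → ℕ → ℕ → ℕ → List (Fin σ) → ℕ
countLong {σ} n k α x =
  sum (map (λ p → if (n ^ α) ≤ᵇ (σ ^ suffLcp k x p) then 1 else 0) (pairs n))

-- all σ^n strings of length n over the alphabet Fin σ
-- (the uniform distribution gives each of them probability σ^-n)
strings : (σ n : ℕ) → List (List (Fin σ))
strings σ zero = [] ∷ []
strings σ (suc n) = concatMap (λ a → map (a ∷_) (strings σ n)) (allFin σ)

-- Σ over all strings of length n of maxLcp  (= σ^n · E[max lcp_k])
sumMaxLcp : (σ n k : ℕ) → ℕ
sumMaxLcp σ n k = sum (map (maxLcp n k) (strings σ n))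

-- Σ over all strings of countLong  (= σ^n · E[#pairs])
sumCount : (σ n k α : ℕ) → ℕ
sumCount σ n k α = sum (map (countLong n k α) (strings σ n))

-- k ≤ log₂ n / log₂ log₂ n, written exactly as (log₂ n)^k ≤ n
-- (valid for n ≥ 3 where log₂ log₂ n > 0): for every rational a/b with
-- a/b < log₂ n (i.e. 2^a < n^b) we have (a/b)^k ≤ n.
KBound : ℕ → ℕ → Set
KBound n k = ∀ a b → 1 Data.Nat.≤ b → 2 ^ a Data.Nat.< n ^ b → a ^ k Data.Nat.≤ n * b ^ k

-- Fix a pair i < j and a length ℓ, and count the strings in which the windows of length ℓ at i and
-- at j are within Hamming distance k. Choosing the letters of the window at i one by one, each letter
-- either equals the letter it is compared with (one choice out of σ) or spends one of the k allowed
-- mismatches; this gives the recurrence N(ℓ+1, k) ≤ N(ℓ, k) + σ N(ℓ, k-1), hence a fraction at most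
-- σ^k (ℓ+1)^k / σ^ℓ of all strings. Take ℓ = L + 1 = ⌈5 log_σ n⌉: the bound on k makes σ^k (ℓ+1)^k at
-- most n², so over the n² pairs the expected number of pairs with lcp_k ≥ ℓ is at most 1/n. This gives
-- (b) with α = 5, and (a) because the maximum is at most L unless such a pair exists, and at most n always.

module Submission where

open import Defs
open import Data.Bool using (Bool; true; false; T; if_then_else_)
open import Data.Bool.Properties using (T-∧)
open import Data.Empty using (⊥-elim)
open import Data.Fin using (Fin; zero; suc)
open import Data.Fin.Properties using (_≟_)
open import Data.List using (List; []; _∷_; length; take; drop; map; concatMap; upTo; allFin; foldr; tabulate; _++_)
open import Data.List.Properties using (map-cong; map-∘; map-++; map-tabulate; length-tabulate; length-drop; drop-drop; length-upTo)
open import Data.List.Relation.Unary.All as All using (All; []; _∷_)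
open import Data.List.Relation.Unary.All.Properties using (all-upTo; concat⁺; map⁺; tabulate⁺)
open import Data.Nat using (ℕ; zero; suc; _+_; _*_; _∸_; _^_; _≤_; _<_; _≤ᵇ_; _⊔_; _≤?_; _<?_; z≤n; s≤s; NonZero; >-nonZero)
open import Data.Nat.ListAction using (sum)
open import Data.Nat.ListAction.Properties using (sum-++)
open import Data.Nat.Properties hiding (_≟_)
open import Data.Nat.Tactic.RingSolver using (solve-∀)
open import Data.Product using (_×_; _,_; proj₁; proj₂; ∃-syntax)
open import Data.Sum using (_⊎_; inj₁; inj₂)
open import Function.Bundles using (Equivalence; _⇔_; mk⇔)
open import Function.Base using (_∘_)
open import Relation.Nullary using (yes; no)
open import Relation.Nullary.Decidable using (⌊_⌋; ⌊⌋-map′)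
open import Relation.Binary.PropositionalEquality using (_≡_; refl; sym; trans; cong; cong₂; subst; module ≡-Reasoning)

𝟙 : Bool → ℕ
𝟙 b = if b then 1 else 0

𝟙-mono : ∀ {a b} → (T a → T b) → 𝟙 a ≤ 𝟙 b
𝟙-mono {false} _ = z≤n
𝟙-mono {true} {true} _ = ≤-refl
𝟙-mono {true} {false} a⇒b = ⊥-elim (a⇒b _)

𝟙-true : ∀ {b} → T b → 𝟙 b ≡ 1
𝟙-true {true} _ = refl

∑ : {A : Set} → List A → (A → ℕ) → ℕ
∑ xs f = sum (map f xs)

module _ {A : Set} where

  ∑-cong : ∀ xs {f g : A → ℕ} → (∀ x → f x ≡ g x) → ∑ xs f ≡ ∑ xs g
  ∑-cong xs f≗g = cong sum (map-cong f≗g xs)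

  ∑-+ : ∀ xs (f g : A → ℕ) → ∑ xs (λ x → f x + g x) ≡ ∑ xs f + ∑ xs g
  ∑-+ [] f g = refl
  ∑-+ (x ∷ xs) f g = trans (cong (f x + g x +_) (∑-+ xs f g)) (+-+-interchange (f x) (g x) _ _)
    where
    +-+-interchange : ∀ a b c d → (a + b) + (c + d) ≡ (a + c) + (b + d)
    +-+-interchange = solve-∀

  ∑-*ˡ : ∀ xs c (f : A → ℕ) → ∑ xs (λ x → c * f x) ≡ c * ∑ xs f
  ∑-*ˡ [] c f = sym (*-zeroʳ c)
  ∑-*ˡ (x ∷ xs) c f = trans (cong (c * f x +_) (∑-*ˡ xs c f)) (sym (*-distribˡ-+ c (f x) _))

  ∑-*ʳ : ∀ xs c (f : A → ℕ) → ∑ xs f * c ≡ ∑ xs (λ x → f x * c)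
  ∑-*ʳ [] c f = refl
  ∑-*ʳ (x ∷ xs) c f = trans (*-distribʳ-+ c (f x) _) (cong (f x * c +_) (∑-*ʳ xs c f))

  ∑-const : ∀ xs c → ∑ xs (λ (_ : A) → c) ≡ length xs * c
  ∑-const [] c = refl
  ∑-const (x ∷ xs) c = cong (c +_) (∑-const xs c)

  ∑-zero : ∀ xs → ∑ xs (λ (_ : A) → 0) ≡ 0
  ∑-zero xs = trans (∑-const xs 0) (*-zeroʳ (length xs))

  ∑-mono : ∀ {xs} {f g : A → ℕ} → All (λ x → f x ≤ g x) xs → ∑ xs f ≤ ∑ xs g
  ∑-mono [] = z≤n
  ∑-mono (fx≤gx ∷ fxs≤gxs) = +-mono-≤ fx≤gx (∑-mono fxs≤gxs)

  ∑-≤-length* : ∀ {xs} {f : A → ℕ} {c} → All (λ x → f x ≤ c) xs → ∑ xs f ≤ length xs * c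
  ∑-≤-length* {xs} {c = c} f≤c = ≤-trans (∑-mono f≤c) (≤-reflexive (∑-const xs c))

  ∑-map : ∀ {B : Set} (h : B → A) bs (f : A → ℕ) → ∑ (map h bs) f ≡ ∑ bs (λ b → f (h b))
  ∑-map h bs f = cong sum (sym (map-∘ bs))

  ∑-concatMap : ∀ {B : Set} (h : B → List A) bs (f : A → ℕ) →
    ∑ (concatMap h bs) f ≡ ∑ bs (λ b → ∑ (h b) f)
  ∑-concatMap h [] f = refl
  ∑-concatMap h (b ∷ bs) f = begin
      sum (map f (h b ++ concatMap h bs))
    ≡⟨ cong sum (map-++ f (h b) (concatMap h bs)) ⟩
      sum (map f (h b) ++ map f (concatMap h bs))
    ≡⟨ sum-++ (map f (h b)) _ ⟩
      ∑ (h b) f + ∑ (concatMap h bs) f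
    ≡⟨ cong (∑ (h b) f +_) (∑-concatMap h bs f) ⟩
      ∑ (h b) f + ∑ bs (λ b → ∑ (h b) f) ∎
    where open ≡-Reasoning

  foldr-⊔-≤-+∑ : ∀ xs (g h : A → ℕ) c → (∀ x → g x ≤ c + h x) →
    foldr _⊔_ 0 (map g xs) ≤ c + ∑ xs h
  foldr-⊔-≤-+∑ [] g h c g≤c+h = z≤n
  foldr-⊔-≤-+∑ (x ∷ xs) g h c g≤c+h = ⊔-lub
    (≤-trans (g≤c+h x) (+-monoʳ-≤ c (m≤m+n (h x) _)))
    (≤-trans (foldr-⊔-≤-+∑ xs g h c g≤c+h) (+-monoʳ-≤ c (m≤n+m _ (h x))))

∑-comm : ∀ {A B : Set} xs ys (g : A → B → ℕ) →
  ∑ xs (λ x → ∑ ys (g x)) ≡ ∑ ys (λ y → ∑ xs (λ x → g x y))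
∑-comm [] ys g = sym (∑-zero ys)
∑-comm (x ∷ xs) ys g =
  trans (cong (∑ ys (g x) +_) (∑-comm xs ys g)) (sym (∑-+ ys (g x) _))

∑-allFin-suc : ∀ m (f : Fin (suc m) → ℕ) →
  ∑ (allFin (suc m)) f ≡ f zero + ∑ (allFin m) (λ a → f (suc a))
∑-allFin-suc m f = cong (f zero +_) (begin
    ∑ (tabulate suc) f
  ≡⟨ cong (λ as → ∑ as f) (sym (map-tabulate (λ a → a) suc)) ⟩
    ∑ (map suc (allFin m)) f
  ≡⟨ ∑-map suc (allFin m) f ⟩
    ∑ (allFin m) (λ a → f (suc a)) ∎)
  where open ≡-Reasoning

∑-allFin-const : ∀ σ c → ∑ (allFin σ) (λ _ → c) ≡ σ * c
∑-allFin-const σ c = trans (∑-const (allFin σ) c) (cong (_* c) (length-tabulate {n = σ} (λ a → a)))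

∑-allFin-mismatch : ∀ {σ} (b : Fin σ) (g : ℕ → ℕ) →
  ∑ (allFin σ) (λ a → g (if ⌊ a ≟ b ⌋ then 0 else 1)) ≤ g 0 + σ * g 1
∑-allFin-mismatch {suc m} zero g = begin
    ∑ (allFin (suc m)) (λ a → g (if ⌊ a ≟ zero ⌋ then 0 else 1))
  ≡⟨ ∑-allFin-suc m _ ⟩
    g 0 + ∑ (allFin m) (λ _ → g 1)
  ≡⟨ cong (g 0 +_) (∑-allFin-const m (g 1)) ⟩
    g 0 + m * g 1
  ≤⟨ +-monoʳ-≤ (g 0) (*-monoˡ-≤ (g 1) (n≤1+n m)) ⟩
    g 0 + suc m * g 1 ∎
  where open ≤-Reasoning
∑-allFin-mismatch {suc m} (suc b) g = begin
    ∑ (allFin (suc m)) (λ a → g (if ⌊ a ≟ suc b ⌋ then 0 else 1))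
  ≡⟨ ∑-allFin-suc m _ ⟩
    g 1 + ∑ (allFin m) (λ a → g (if ⌊ suc a ≟ suc b ⌋ then 0 else 1))
  ≡⟨ cong (g 1 +_) (∑-cong (allFin m) λ a →
       cong (λ e → g (if e then 0 else 1)) (⌊⌋-map′ _ _ (a ≟ b))) ⟩
    g 1 + ∑ (allFin m) (λ a → g (if ⌊ a ≟ b ⌋ then 0 else 1))
  ≤⟨ +-monoʳ-≤ (g 1) (∑-allFin-mismatch b g) ⟩
    g 1 + (g 0 + m * g 1)
  ≡⟨ +-comm-middle (g 0) (g 1) m ⟩
    g 0 + suc m * g 1 ∎
  where
  open ≤-Reasoning
  +-comm-middle : ∀ x y m → y + (x + m * y) ≡ x + (y + m * y)
  +-comm-middle = solve-∀

module _ {σ : ℕ} where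

  ∑-strings-suc : ∀ n (f : List (Fin σ) → ℕ) →
    ∑ (strings σ (suc n)) f ≡ ∑ (allFin σ) (λ a → ∑ (strings σ n) (λ x → f (a ∷ x)))
  ∑-strings-suc n f =
    trans (∑-concatMap _ (allFin σ) f) (∑-cong (allFin σ) λ a → ∑-map (a ∷_) (strings σ n) f)

  ∑-strings-const : ∀ n c → ∑ (strings σ n) (λ _ → c) ≡ σ ^ n * c
  ∑-strings-const zero c = refl
  ∑-strings-const (suc n) c = begin
      ∑ (strings σ (suc n)) (λ _ → c)
    ≡⟨ ∑-strings-suc n _ ⟩
      ∑ (allFin σ) (λ _ → ∑ (strings σ n) (λ _ → c))
    ≡⟨ ∑-cong (allFin σ) (λ _ → ∑-strings-const n c) ⟩
      ∑ (allFin σ) (λ _ → σ ^ n * c)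
    ≡⟨ ∑-allFin-const σ _ ⟩
      σ * (σ ^ n * c)
    ≡⟨ sym (*-assoc σ (σ ^ n) c) ⟩
      σ ^ suc n * c ∎
    where open ≡-Reasoning

  ∑-strings-drop : ∀ i n (f : List (Fin σ) → ℕ) → i ≤ n →
    ∑ (strings σ n) (λ x → f (drop i x)) ≡ σ ^ i * ∑ (strings σ (n ∸ i)) f
  ∑-strings-drop zero n f _ = sym (*-identityˡ _)
  ∑-strings-drop (suc i) (suc n) f (s≤s i≤n) = begin
      ∑ (strings σ (suc n)) (λ x → f (drop (suc i) x))
    ≡⟨ ∑-strings-suc n _ ⟩
      ∑ (allFin σ) (λ _ → ∑ (strings σ n) (λ x → f (drop i x)))
    ≡⟨ ∑-cong (allFin σ) (λ _ → ∑-strings-drop i n f i≤n) ⟩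
      ∑ (allFin σ) (λ _ → σ ^ i * ∑ (strings σ (n ∸ i)) f)
    ≡⟨ ∑-allFin-const σ _ ⟩
      σ * (σ ^ i * ∑ (strings σ (n ∸ i)) f)
    ≡⟨ sym (*-assoc σ (σ ^ i) _) ⟩
      σ ^ suc i * ∑ (strings σ (n ∸ i)) f ∎
    where open ≡-Reasoning

  strings-length : ∀ n → All (λ x → length x ≡ n) (strings σ n)
  strings-length zero = refl ∷ []
  strings-length (suc n) =
    concat⁺ (map⁺ (tabulate⁺ λ a → map⁺ {f = a ∷_} (All.map (cong suc) (strings-length n))))

  ∑-strings-mono : ∀ n {f g : List (Fin σ) → ℕ} → (∀ x → length x ≡ n → f x ≤ g x) →
    ∑ (strings σ n) f ≤ ∑ (strings σ n) g
  ∑-strings-mono n f≤g = ∑-mono (All.map (f≤g _) (strings-length n))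

suc≤ᵇsuc : ∀ m n → (suc m ≤ᵇ suc n) ≡ (m ≤ᵇ n)
suc≤ᵇsuc zero n = refl
suc≤ᵇsuc (suc m) n = refl

drop-uncons : ∀ {A : Set} d (xs : List A) → d < length xs → ∃[ b ] drop d xs ≡ b ∷ drop (suc d) xs
drop-uncons zero (x ∷ xs) _ = x , refl
drop-uncons (suc d) (x ∷ xs) (s≤s d<|xs|) = drop-uncons d xs d<|xs|

-- The bound σ^n σ^k (L+1)^k / σ^L satisfies N(L+1, k) ≤ N(L, k) + σ N(L, k-1), for k = 0 and k > 0.
budget-step-zero : ∀ s A P N → A * P ≤ N * (1 * 1) → (A + s * 0) * (s * P) ≤ (s * N) * (1 * 1)
budget-step-zero s A P N AP≤N = begin
    (A + s * 0) * (s * P)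
  ≡⟨ rearrange s A P ⟩
    s * (A * P)
  ≤⟨ *-monoʳ-≤ s AP≤N ⟩
    s * (N * (1 * 1))
  ≡⟨ sym (*-assoc s N _) ⟩
    (s * N) * (1 * 1) ∎
  where
  open ≤-Reasoning
  rearrange : ∀ s A P → (A + s * 0) * (s * P) ≡ s * (A * P)
  rearrange = solve-∀

budget-step-suc : ∀ s A B P N S M Q Q′ →
  A * P ≤ N * ((s * S) * (M * Q)) → B * P ≤ N * (S * Q) → Q ≤ Q′ →
  (A + s * B) * (s * P) ≤ (s * N) * ((s * S) * (suc M * Q′))
budget-step-suc s A B P N S M Q Q′ AP≤ BP≤ Q≤Q′ = begin
    (A + s * B) * (s * P)
  ≡⟨ expand s A B P ⟩
    s * (A * P) + s * (s * (B * P))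
  ≤⟨ +-mono-≤ (*-monoʳ-≤ s AP≤) (*-monoʳ-≤ s (*-monoʳ-≤ s BP≤)) ⟩
    s * (N * ((s * S) * (M * Q))) + s * (s * (N * (S * Q)))
  ≡⟨ collect s N S M Q ⟩
    (s * N) * ((s * S) * (suc M * Q))
  ≤⟨ *-monoʳ-≤ (s * N) (*-monoʳ-≤ (s * S) (*-monoʳ-≤ (suc M) Q≤Q′)) ⟩
    (s * N) * ((s * S) * (suc M * Q′)) ∎
  where
  open ≤-Reasoning
  expand : ∀ s A B P → (A + s * B) * (s * P) ≡ s * (A * P) + s * (s * (B * P))
  expand = solve-∀
  collect : ∀ s N S M Q →
    s * (N * ((s * S) * (M * Q))) + s * (s * (N * (S * Q))) ≡ (s * N) * ((s * S) * (suc M * Q))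
  collect = solve-∀

module _ {σ : ℕ} where

  hamWindows : ℕ → ℕ → List (Fin σ) → ℕ
  hamWindows d L x = ham (take L x) (take L (drop d x))

  windowMatches : ℕ → ℕ → ℕ → ℕ → ℕ
  windowMatches k d L n = ∑ (strings σ n) (λ x → 𝟙 (hamWindows d L x ≤ᵇ k))

  -- Prepending a letter a compares it with x[d], then compares the old windows.
  ∑-first-letter : ∀ k d L (x : List (Fin σ)) → d < length x →
    ∑ (allFin σ) (λ a → 𝟙 (hamWindows (suc d) (suc L) (a ∷ x) ≤ᵇ k))
      ≤ 𝟙 (hamWindows (suc d) L x ≤ᵇ k) + σ * 𝟙 (suc (hamWindows (suc d) L x) ≤ᵇ k)
  ∑-first-letter k d L x d<|x| with drop-uncons d x d<|x|
  ... | b , drop-d≡b∷ =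
    subst (λ t → ∑ (allFin σ) (λ a → 𝟙 (ham (a ∷ take L x) (take (suc L) t) ≤ᵇ k)) ≤ g 0 + σ * g 1)
          (sym drop-d≡b∷) (∑-allFin-mismatch b g)
    where
    g : ℕ → ℕ
    g e = 𝟙 (e + hamWindows (suc d) L x ≤ᵇ k)

  windowMatches-step : ∀ k d L n → d < n →
    windowMatches k (suc d) (suc L) (suc n)
      ≤ windowMatches k (suc d) L n
        + σ * ∑ (strings σ n) (λ x → 𝟙 (suc (hamWindows (suc d) L x) ≤ᵇ k))
  windowMatches-step k d L n d<n = begin
      windowMatches k (suc d) (suc L) (suc n)
    ≡⟨ ∑-strings-suc n (matches (suc L)) ⟩
      ∑ (allFin σ) (λ a → ∑ (strings σ n) (λ x → matches (suc L) (a ∷ x)))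
    ≡⟨ ∑-comm (allFin σ) (strings σ n) _ ⟩
      ∑ (strings σ n) (λ x → ∑ (allFin σ) (λ a → matches (suc L) (a ∷ x)))
    ≤⟨ ∑-strings-mono n (λ x |x|≡n → ∑-first-letter k d L x (subst (d <_) (sym |x|≡n) d<n)) ⟩
      ∑ (strings σ n) (λ x → matches L x + σ * 𝟙 (suc (h x) ≤ᵇ k))
    ≡⟨ ∑-+ (strings σ n) _ _ ⟩
      windowMatches k (suc d) L n + ∑ (strings σ n) (λ x → σ * 𝟙 (suc (h x) ≤ᵇ k))
    ≡⟨ cong (windowMatches k (suc d) L n +_) (∑-*ˡ (strings σ n) σ _) ⟩
      windowMatches k (suc d) L n + σ * ∑ (strings σ n) (λ x → 𝟙 (suc (h x) ≤ᵇ k)) ∎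
    where
    open ≤-Reasoning
    h : List (Fin σ) → ℕ
    h = hamWindows (suc d) L
    matches : ℕ → List (Fin σ) → ℕ
    matches ℓ x = 𝟙 (hamWindows (suc d) ℓ x ≤ᵇ k)

  windowMatches-bound : {{_ : NonZero σ}} → ∀ k d L n → L + suc d ≤ n →
    windowMatches k (suc d) L n * σ ^ L ≤ σ ^ n * (σ ^ k * suc L ^ k)
  windowMatches-bound k d zero n _ = begin
      windowMatches k (suc d) 0 n * 1
    ≡⟨ trans (*-identityʳ _) (∑-strings-const n 1) ⟩
      σ ^ n * 1
    ≤⟨ *-monoʳ-≤ (σ ^ n) (≤-trans (m^n>0 σ k) (≤-reflexive σ^k≡σ^k*1^k)) ⟩
      σ ^ n * (σ ^ k * 1 ^ k) ∎
    where
    open ≤-Reasoning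
    σ^k≡σ^k*1^k : σ ^ k ≡ σ ^ k * 1 ^ k
    σ^k≡σ^k*1^k = sym (trans (cong (σ ^ k *_) (^-zeroˡ k)) (*-identityʳ _))
  windowMatches-bound zero d (suc L) (suc n) (s≤s L+d<n) = begin
      windowMatches 0 (suc d) (suc L) (suc n) * σ ^ suc L
    ≤⟨ *-monoˡ-≤ _ (windowMatches-step 0 d L n d<n) ⟩
      (windowMatches 0 (suc d) L n + σ * ∑ (strings σ n) (λ _ → 0)) * σ ^ suc L
    ≡⟨ cong (λ t → (windowMatches 0 (suc d) L n + σ * t) * σ ^ suc L) (∑-zero (strings σ n)) ⟩
      (windowMatches 0 (suc d) L n + σ * 0) * σ ^ suc L
    ≤⟨ budget-step-zero σ (windowMatches 0 (suc d) L n) (σ ^ L) (σ ^ n)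
         (windowMatches-bound 0 d L n L+d<n) ⟩
      σ ^ suc n * (1 * 1) ∎
    where
    open ≤-Reasoning
    d<n : d < n
    d<n = m+n≤o⇒n≤o L L+d<n
  windowMatches-bound (suc k) d (suc L) (suc n) (s≤s L+d<n) = begin
      windowMatches (suc k) (suc d) (suc L) (suc n) * σ ^ suc L
    ≤⟨ *-monoˡ-≤ _ (windowMatches-step (suc k) d L n d<n) ⟩
      (windowMatches (suc k) (suc d) L n + σ * ∑ (strings σ n) (λ x → 𝟙 (suc (h x) ≤ᵇ suc k)))
        * σ ^ suc L
    ≡⟨ cong (λ t → (windowMatches (suc k) (suc d) L n + σ * t) * σ ^ suc L)
         (∑-cong (strings σ n) λ x → cong 𝟙 (suc≤ᵇsuc (h x) k)) ⟩
      (windowMatches (suc k) (suc d) L n + σ * windowMatches k (suc d) L n) * σ ^ suc L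
    ≤⟨ budget-step-suc σ (windowMatches (suc k) (suc d) L n) (windowMatches k (suc d) L n) (σ ^ L) (σ ^ n)
         (σ ^ k) (suc L) (suc L ^ k) (suc (suc L) ^ k)
         (windowMatches-bound (suc k) d L n L+d<n) (windowMatches-bound k d L n L+d<n)
         (^-monoˡ-≤ k (n≤1+n (suc L))) ⟩
      σ ^ suc n * (σ ^ suc k * suc (suc L) ^ suc k) ∎
    where
    open ≤-Reasoning
    h : List (Fin σ) → ℕ
    h = hamWindows (suc d) L
    d<n : d < n
    d<n = m+n≤o⇒n≤o L L+d<n

∑-pairs-≤ : ∀ n (g : ℕ × ℕ → ℕ) c → (∀ {i j} → i < j → j < n → g (i , j) ≤ c) →
  ∑ (pairs n) g ≤ n * (n * c)
∑-pairs-≤ n g c g≤c = begin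
    ∑ (pairs n) g
  ≡⟨ ∑-concatMap _ (upTo n) g ⟩
    ∑ (upTo n) (λ j → ∑ (map (_, j) (upTo j)) g)
  ≡⟨ ∑-cong (upTo n) (λ j → ∑-map (_, j) (upTo j) g) ⟩
    ∑ (upTo n) (λ j → ∑ (upTo j) (λ i → g (i , j)))
  ≤⟨ ∑-≤-length* (All.map (λ {j} j<n → column-≤ j<n) (all-upTo n)) ⟩
    length (upTo n) * (n * c)
  ≡⟨ cong (_* (n * c)) (length-upTo n) ⟩
    n * (n * c) ∎
  where
  open ≤-Reasoning
  column-≤ : ∀ {j} → j < n → ∑ (upTo j) (λ i → g (i , j)) ≤ n * c
  column-≤ {j} j<n = begin
      ∑ (upTo j) (λ i → g (i , j))
    ≤⟨ ∑-≤-length* (All.map (λ i<j → g≤c i<j j<n) (all-upTo j)) ⟩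
      length (upTo j) * c
    ≡⟨ cong (_* c) (length-upTo j) ⟩
      j * c
    ≤⟨ *-monoˡ-≤ c (<⇒≤ j<n) ⟩
      n * c ∎

module _ {σ : ℕ} where

  ham-take-mono : ∀ (y z : List (Fin σ)) {L ℓ} → L ≤ ℓ →
    ham (take L y) (take L z) ≤ ham (take ℓ y) (take ℓ z)
  ham-take-mono y z {zero} _ = z≤n
  ham-take-mono [] z {suc L} {suc ℓ} _ = z≤n
  ham-take-mono (a ∷ y) [] {suc L} {suc ℓ} _ = z≤n
  ham-take-mono (a ∷ y) (b ∷ z) {suc L} {suc ℓ} (s≤s L≤ℓ) =
    +-monoʳ-≤ (if ⌊ a ≟ b ⌋ then 0 else 1) (ham-take-mono y z L≤ℓ)

  lcpOK-⇔ : ∀ k (y z : List (Fin σ)) ℓ →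
    T (lcpOK k y z ℓ) ⇔ (ℓ ≤ length y × ℓ ≤ length z × ham (take ℓ y) (take ℓ z) ≤ k)
  lcpOK-⇔ k y z ℓ = mk⇔ to from
    where
    to : T (lcpOK k y z ℓ) → ℓ ≤ length y × ℓ ≤ length z × ham (take ℓ y) (take ℓ z) ≤ k
    to ok = let ℓ≤|y| , rest = Equivalence.to T-∧ ok
                ℓ≤|z| , close = Equivalence.to T-∧ rest
            in ≤ᵇ⇒≤ _ _ ℓ≤|y| , ≤ᵇ⇒≤ _ _ ℓ≤|z| , ≤ᵇ⇒≤ _ _ close
    from : ℓ ≤ length y × ℓ ≤ length z × ham (take ℓ y) (take ℓ z) ≤ k → T (lcpOK k y z ℓ)
    from (ℓ≤|y| , ℓ≤|z| , close) =
      Equivalence.from T-∧ (≤⇒≤ᵇ ℓ≤|y| ,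
        Equivalence.from T-∧ (≤⇒≤ᵇ ℓ≤|z| , ≤⇒≤ᵇ close))

  lcpOK-antitone : ∀ k (y z : List (Fin σ)) {L ℓ} → L ≤ ℓ → T (lcpOK k y z ℓ) → T (lcpOK k y z L)
  lcpOK-antitone k y z {L} {ℓ} L≤ℓ ok with Equivalence.to (lcpOK-⇔ k y z ℓ) ok
  ... | ℓ≤|y| , ℓ≤|z| , close = Equivalence.from (lcpOK-⇔ k y z L)
    (≤-trans L≤ℓ ℓ≤|y| , ≤-trans L≤ℓ ℓ≤|z| , ≤-trans (ham-take-mono y z L≤ℓ) close)

maxSat-≤ : ∀ P m → maxSat P m ≤ m
maxSat-≤ P zero = z≤n
maxSat-≤ P (suc m) with P (suc m)
... | true = ≤-refl
... | false = m≤n⇒m≤1+n (maxSat-≤ P m)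

maxSat-sat : ∀ P m → maxSat P m ≡ 0 ⊎ T (P (maxSat P m))
maxSat-sat P zero = inj₁ refl
maxSat-sat P (suc m) with P (suc m) in eq
... | true = inj₂ (subst T (sym eq) _)
... | false = maxSat-sat P m

module _ {σ : ℕ} (k : ℕ) (y z : List (Fin σ)) where

  lcpK-≤-length : lcpK k y z ≤ length y
  lcpK-≤-length = maxSat-≤ (lcpOK k y z) (length y)

  ≤lcpK⇒lcpOK : ∀ {ℓ} → suc ℓ ≤ lcpK k y z → T (lcpOK k y z (suc ℓ))
  ≤lcpK⇒lcpOK ℓ<lcp with maxSat-sat (lcpOK k y z) (length y)
  ... | inj₁ lcp≡0 = ⊥-elim (<⇒≱ (≤-trans (s≤s z≤n) ℓ<lcp) (≤-reflexive lcp≡0))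
  ... | inj₂ ok = lcpOK-antitone k y z ℓ<lcp ok

module _ {σ : ℕ} (k : ℕ) where

  matchingPair : ℕ → List (Fin σ) → ℕ × ℕ → ℕ
  matchingPair ℓ x (i , j) = 𝟙 (lcpOK k (drop i x) (drop j x) ℓ)

  matchingPairs : ℕ → ℕ → List (Fin σ) → ℕ
  matchingPairs n ℓ x = ∑ (pairs n) (matchingPair ℓ x)

  maxLcp-≤ : ∀ n L (x : List (Fin σ)) → maxLcp n k x ≤ L + length x * matchingPairs n (suc L) x
  maxLcp-≤ n L x = ≤-trans (foldr-⊔-≤-+∑ (pairs n) (suffLcp k x) _ L suffLcp-≤)
                           (≤-reflexive (cong (L +_) (∑-*ˡ (pairs n) (length x) _)))
    where
    suffLcp-≤ : ∀ p → suffLcp k x p ≤ L + length x * matchingPair (suc L) x p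
    suffLcp-≤ (i , j) with suffLcp k x (i , j) ≤? L
    ... | yes lcp≤L = ≤-trans lcp≤L (m≤m+n L _)
    ... | no lcp≰L = begin
        suffLcp k x (i , j)
      ≤⟨ lcpK-≤-length k (drop i x) (drop j x) ⟩
        length (drop i x)
      ≡⟨ length-drop i x ⟩
        length x ∸ i
      ≤⟨ m∸n≤m (length x) i ⟩
        length x
      ≡⟨ sym (trans (cong (length x *_) (𝟙-true matching)) (*-identityʳ _)) ⟩
        length x * matchingPair (suc L) x (i , j)
      ≤⟨ m≤n+m _ L ⟩
        L + length x * matchingPair (suc L) x (i , j) ∎
      where
      open ≤-Reasoning
      matching : T (lcpOK k (drop i x) (drop j x) (suc L))
      matching = ≤lcpK⇒lcpOK k (drop i x) (drop j x) (≰⇒> lcp≰L)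

  matchingPair⇒hamWindows : ∀ ℓ i d (x : List (Fin σ)) →
    T (lcpOK k (drop i x) (drop (i + d) x) ℓ) → T (hamWindows d ℓ (drop i x) ≤ᵇ k)
  matchingPair⇒hamWindows ℓ i d x ok =
    ≤⇒≤ᵇ (subst (λ t → ham (take ℓ (drop i x)) (take ℓ t) ≤ k) (sym (drop-drop i d x)) close)
    where
    close : ham (take ℓ (drop i x)) (take ℓ (drop (i + d) x)) ≤ k
    close = proj₂ (proj₂ (Equivalence.to (lcpOK-⇔ k (drop i x) (drop (i + d) x) ℓ) ok))

  matchingPair⇒fits : ∀ ℓ i j (x : List (Fin σ)) {n} → length x ≡ n → j ≤ n →
    T (lcpOK k (drop i x) (drop j x) ℓ) → ℓ + j ≤ n
  matchingPair⇒fits ℓ i j x {n} |x|≡n j≤n ok = begin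
      ℓ + j
    ≤⟨ +-monoˡ-≤ j (proj₁ (proj₂ (Equivalence.to (lcpOK-⇔ k (drop i x) (drop j x) ℓ) ok))) ⟩
      length (drop j x) + j
    ≡⟨ cong (_+ j) (trans (length-drop j x) (cong (_∸ j) |x|≡n)) ⟩
      n ∸ j + j
    ≡⟨ m∸n+n≡m j≤n ⟩
      n ∎
    where open ≤-Reasoning

  countLong-≤ : ∀ n α L (x : List (Fin σ)) → (∀ ℓ → n ^ α ≤ σ ^ ℓ → suc L ≤ ℓ) →
    countLong n k α x ≤ matchingPairs n (suc L) x
  countLong-≤ n α L x threshold = ∑-mono (All.universal long⇒matching (pairs n))
    where
    long⇒matching : ∀ p → 𝟙 (n ^ α ≤ᵇ σ ^ suffLcp k x p) ≤ matchingPair (suc L) x p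
    long⇒matching (i , j) =
      𝟙-mono (λ long → ≤lcpK⇒lcpOK k (drop i x) (drop j x) (threshold _ (≤ᵇ⇒≤ _ _ long)))

module _ {σ : ℕ} {{_ : NonZero σ}} (k : ℕ) where

  matchingPair-total : ∀ n ℓ {i j} → i < j → j ≤ n →
    ∑ (strings σ n) (λ x → matchingPair k ℓ x (i , j)) * σ ^ ℓ ≤ σ ^ n * (σ ^ k * suc ℓ ^ k)
  matchingPair-total n ℓ {i} i<j j≤n with m≤n⇒∃[o]m+o≡n i<j
  ... | d , refl rewrite sym (+-suc i d) with ℓ + (i + suc d) ≤? n
  ...   | yes fits = begin
      ∑ (strings σ n) (λ x → 𝟙 (lcpOK k (drop i x) (drop (i + suc d) x) ℓ)) * σ ^ ℓ
    ≤⟨ *-monoˡ-≤ _ (∑-strings-mono n λ x _ →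
         𝟙-mono (matchingPair⇒hamWindows k ℓ i (suc d) x)) ⟩
      ∑ (strings σ n) (λ x → 𝟙 (hamWindows (suc d) ℓ (drop i x) ≤ᵇ k)) * σ ^ ℓ
    ≡⟨ cong (_* σ ^ ℓ) (∑-strings-drop i n _ i≤n) ⟩
      σ ^ i * windowMatches k (suc d) ℓ (n ∸ i) * σ ^ ℓ
    ≡⟨ *-assoc (σ ^ i) _ _ ⟩
      σ ^ i * (windowMatches k (suc d) ℓ (n ∸ i) * σ ^ ℓ)
    ≤⟨ *-monoʳ-≤ (σ ^ i) (windowMatches-bound k d ℓ (n ∸ i) fits-after-i) ⟩
      σ ^ i * (σ ^ (n ∸ i) * (σ ^ k * suc ℓ ^ k))
    ≡⟨ sym (*-assoc (σ ^ i) _ _) ⟩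
      σ ^ i * σ ^ (n ∸ i) * (σ ^ k * suc ℓ ^ k)
    ≡⟨ cong (_* (σ ^ k * suc ℓ ^ k)) σ^i*σ^[n∸i]≡σ^n ⟩
      σ ^ n * (σ ^ k * suc ℓ ^ k) ∎
    where
    open ≤-Reasoning
    i≤n : i ≤ n
    i≤n = m+n≤o⇒m≤o i j≤n
    σ^i*σ^[n∸i]≡σ^n : σ ^ i * σ ^ (n ∸ i) ≡ σ ^ n
    σ^i*σ^[n∸i]≡σ^n = trans (sym (^-distribˡ-+-* σ i (n ∸ i))) (cong (σ ^_) (m+[n∸m]≡n i≤n))
    fits-after-i : ℓ + suc d ≤ n ∸ i
    fits-after-i = m+n≤o⇒m≤o∸n (ℓ + suc d) (≤-trans (≤-reflexive (reorder ℓ (suc d) i)) fits)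
      where
      reorder : ∀ a b c → a + b + c ≡ a + (c + b)
      reorder = solve-∀
  ...   | no overflows = begin
      ∑ (strings σ n) (λ x → 𝟙 (lcpOK k (drop i x) (drop (i + suc d) x) ℓ)) * σ ^ ℓ
    ≤⟨ *-monoˡ-≤ _ (∑-strings-mono n λ x |x|≡n →
         𝟙-mono {b = false} (overflows ∘ matchingPair⇒fits k ℓ i (i + suc d) x |x|≡n j≤n)) ⟩
      ∑ (strings σ n) (λ _ → 0) * σ ^ ℓ
    ≡⟨ cong (_* σ ^ ℓ) (∑-zero (strings σ n)) ⟩
      0
    ≤⟨ z≤n ⟩
      σ ^ n * (σ ^ k * suc ℓ ^ k) ∎
    where open ≤-Reasoning

  matchingPairs-total : ∀ n ℓ →
    ∑ (strings σ n) (matchingPairs k n ℓ) * σ ^ ℓ ≤ n * (n * (σ ^ n * (σ ^ k * suc ℓ ^ k)))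
  matchingPairs-total n ℓ = begin
      ∑ (strings σ n) (λ x → ∑ (pairs n) (matchingPair k ℓ x)) * σ ^ ℓ
    ≡⟨ cong (_* σ ^ ℓ) (∑-comm (strings σ n) (pairs n) (matchingPair k ℓ)) ⟩
      ∑ (pairs n) (λ p → ∑ (strings σ n) (λ x → matchingPair k ℓ x p)) * σ ^ ℓ
    ≡⟨ ∑-*ʳ (pairs n) (σ ^ ℓ) _ ⟩
      ∑ (pairs n) (λ p → ∑ (strings σ n) (λ x → matchingPair k ℓ x p) * σ ^ ℓ)
    ≤⟨ ∑-pairs-≤ n _ _ (λ i<j j<n → matchingPair-total n ℓ i<j (<⇒≤ j<n)) ⟩
      n * (n * (σ ^ n * (σ ^ k * suc ℓ ^ k))) ∎
    where open ≤-Reasoning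

n<2^n : ∀ n → n < 2 ^ n
n<2^n zero = s≤s z≤n
n<2^n (suc n) = +-mono-≤ (≤-trans (s≤s z≤n) (n<2^n n)) (≤-trans (n<2^n n) (m≤m+n (2 ^ n) 0))

*-^-distrib : ∀ a b k → (a * b) ^ k ≡ a ^ k * b ^ k
*-^-distrib a b zero = refl
*-^-distrib a b (suc k) = trans (cong (a * b *_) (*-^-distrib a b k)) (interchange a b (a ^ k) (b ^ k))
  where
  interchange : ∀ a b x y → a * b * (x * y) ≡ a * x * (b * y)
  interchange = solve-∀

exp-bracket : ∀ {b N} → 2 ≤ b → 1 < N → ∃[ L ] b ^ L < N × N ≤ b ^ suc L
exp-bracket {b} {N} 2≤b 1<N = search N (≤-trans (<⇒≤ (n<2^n N)) (^-monoˡ-≤ N 2≤b))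
  where
  search : ∀ t → N ≤ b ^ t → ∃[ L ] b ^ L < N × N ≤ b ^ suc L
  search zero N≤1 = ⊥-elim (<⇒≱ 1<N N≤1)
  search (suc t) N≤b^1+t with N ≤? b ^ t
  ... | yes N≤b^t = search t N≤b^t
  ... | no N≰b^t = t , ≰⇒> N≰b^t , N≤b^1+t

module LongStrings {σ n k : ℕ} (2≤σ : 2 ≤ σ) (2^6σ<n : 2 ^ (6 * σ) < n) (k-small : KBound n k) where

  6σ<n : 6 * σ < n
  6σ<n = <-trans (n<2^n (6 * σ)) 2^6σ<n

  σ≤n : σ ≤ n
  σ≤n = ≤-trans (m≤m+n σ (5 * σ)) (<⇒≤ 6σ<n)

  4≤n : 4 ≤ n
  4≤n = ≤-trans (m≤m+n 4 8) (≤-trans (*-monoʳ-≤ 6 2≤σ) (<⇒≤ 6σ<n))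

  instance
    σ-nonZero : NonZero σ
    σ-nonZero = >-nonZero (≤-trans (s≤s z≤n) 2≤σ)
    n-nonZero : NonZero n
    n-nonZero = >-nonZero (≤-trans (s≤s z≤n) 4≤n)
    n^5-nonZero : NonZero (n ^ 5)
    n^5-nonZero = m^n≢0 n 5

  1<n^5 : 1 < n ^ 5
  1<n^5 = ≤-trans (≤-trans (s≤s (s≤s z≤n)) 4≤n) (m≤m*n n (n ^ 4) {{m^n≢0 n 4}})

  L : ℕ
  L = proj₁ (exp-bracket 2≤σ 1<n^5)

  σ^L<n^5 : σ ^ L < n ^ 5
  σ^L<n^5 = proj₁ (proj₂ (exp-bracket 2≤σ 1<n^5))

  n^5≤σ^1+L : n ^ 5 ≤ σ ^ suc L
  n^5≤σ^1+L = proj₂ (proj₂ (exp-bracket 2≤σ 1<n^5))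

  long⇒>L : ∀ ℓ → n ^ 5 ≤ σ ^ ℓ → suc L ≤ ℓ
  long⇒>L ℓ n^5≤σ^ℓ with L <? ℓ
  ... | yes L<ℓ = L<ℓ
  ... | no L≮ℓ = ⊥-elim (<⇒≱ σ^L<n^5 (≤-trans n^5≤σ^ℓ (^-monoʳ-≤ σ (≮⇒≥ L≮ℓ))))

  -- This is where KBound enters: (2 + L)^k ≤ n 6^k and (6σ)^k ≤ n.
  budget-≤ : σ ^ k * suc (suc L) ^ k ≤ n * n
  budget-≤ = begin
      σ ^ k * suc (suc L) ^ k
    ≤⟨ *-monoʳ-≤ (σ ^ k) (k-small (suc (suc L)) 6 (s≤s z≤n) 2^[2+L]<n^6) ⟩
      σ ^ k * (n * 6 ^ k)
    ≡⟨ rearrange (σ ^ k) n (6 ^ k) ⟩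
      n * (6 ^ k * σ ^ k)
    ≡⟨ cong (n *_) (sym (*-^-distrib 6 σ k)) ⟩
      n * (6 * σ) ^ k
    ≤⟨ *-monoʳ-≤ n (k-small (6 * σ) 1 ≤-refl 2^6σ<n^1) ⟩
      n * (n * 1 ^ k)
    ≡⟨ cong (λ t → n * (n * t)) (^-zeroˡ k) ⟩
      n * (n * 1)
    ≡⟨ cong (n *_) (*-identityʳ n) ⟩
      n * n ∎
    where
    open ≤-Reasoning
    rearrange : ∀ a b c → a * (b * c) ≡ b * (c * a)
    rearrange = solve-∀
    2^6σ<n^1 : 2 ^ (6 * σ) < n ^ 1
    2^6σ<n^1 = ≤-trans 2^6σ<n (≤-reflexive (sym (*-identityʳ n)))
    2^[2+L]<n^6 : 2 ^ suc (suc L) < n ^ 6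
    2^[2+L]<n^6 = begin-strict
        2 ^ suc (suc L)
      ≡⟨ sym (*-assoc 2 2 (2 ^ L)) ⟩
        4 * 2 ^ L
      ≤⟨ *-monoʳ-≤ 4 (^-monoˡ-≤ L 2≤σ) ⟩
        4 * σ ^ L
      <⟨ *-monoʳ-< 4 σ^L<n^5 ⟩
        4 * n ^ 5
      ≤⟨ *-monoˡ-≤ (n ^ 5) 4≤n ⟩
        n ^ 6 ∎

  matches : ℕ
  matches = ∑ (strings σ n) (matchingPairs k n (suc L))

  n*matches≤σ^n : n * matches ≤ σ ^ n
  n*matches≤σ^n = *-cancelʳ-≤ (n * matches) (σ ^ n) (n ^ 5) (begin
      n * matches * n ^ 5
    ≡⟨ *-assoc n matches (n ^ 5) ⟩
      n * (matches * n ^ 5)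
    ≤⟨ *-monoʳ-≤ n (*-monoʳ-≤ matches n^5≤σ^1+L) ⟩
      n * (matches * σ ^ suc L)
    ≤⟨ *-monoʳ-≤ n (matchingPairs-total k n (suc L)) ⟩
      n * (n * (n * (σ ^ n * (σ ^ k * suc (suc L) ^ k))))
    ≤⟨ *-monoʳ-≤ n (*-monoʳ-≤ n (*-monoʳ-≤ n (*-monoʳ-≤ (σ ^ n) budget-≤))) ⟩
      n * (n * (n * (σ ^ n * (n * n))))
    ≡⟨ rearrange n (σ ^ n) ⟩
      σ ^ n * n ^ 5 ∎)
    where
    open ≤-Reasoning
    rearrange : ∀ n s → n * (n * (n * (s * (n * n)))) ≡ s * (n * (n * (n * (n * (n * 1)))))
    rearrange = solve-∀

  sumMaxLcp-≤ : sumMaxLcp σ n k ≤ σ ^ n * suc L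
  sumMaxLcp-≤ = begin
      ∑ (strings σ n) (maxLcp n k)
    ≤⟨ ∑-strings-mono n (λ x |x|≡n →
         subst (λ m → maxLcp n k x ≤ L + m * matchingPairs k n (suc L) x) |x|≡n (maxLcp-≤ k n L x)) ⟩
      ∑ (strings σ n) (λ x → L + n * matchingPairs k n (suc L) x)
    ≡⟨ ∑-+ (strings σ n) (λ _ → L) _ ⟩
      ∑ (strings σ n) (λ _ → L) + ∑ (strings σ n) (λ x → n * matchingPairs k n (suc L) x)
    ≡⟨ cong₂ _+_ (∑-strings-const n L) (∑-*ˡ (strings σ n) n _) ⟩
      σ ^ n * L + n * matches
    ≤⟨ +-monoʳ-≤ (σ ^ n * L) n*matches≤σ^n ⟩
      σ ^ n * L + σ ^ n
    ≡⟨ trans (+-comm _ (σ ^ n)) (sym (*-suc (σ ^ n) L)) ⟩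
      σ ^ n * suc L ∎
    where open ≤-Reasoning

  σ^sumMaxLcp-≤ : σ ^ sumMaxLcp σ n k ≤ n ^ (6 * σ ^ n)
  σ^sumMaxLcp-≤ = begin
      σ ^ sumMaxLcp σ n k
    ≤⟨ ^-monoʳ-≤ σ sumMaxLcp-≤ ⟩
      σ ^ (σ ^ n * suc L)
    ≡⟨ cong (σ ^_) (*-comm (σ ^ n) (suc L)) ⟩
      σ ^ (suc L * σ ^ n)
    ≡⟨ sym (^-*-assoc σ (suc L) (σ ^ n)) ⟩
      (σ ^ suc L) ^ (σ ^ n)
    ≤⟨ ^-monoˡ-≤ (σ ^ n) (*-mono-≤ σ≤n (<⇒≤ σ^L<n^5)) ⟩
      (n ^ 6) ^ (σ ^ n)
    ≡⟨ ^-*-assoc n 6 (σ ^ n) ⟩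
      n ^ (6 * σ ^ n) ∎
    where open ≤-Reasoning

  sumCount-≤ : sumCount σ n k 5 ≤ 1 * σ ^ n
  sumCount-≤ = begin
      ∑ (strings σ n) (countLong n k 5)
    ≤⟨ ∑-strings-mono n (λ x _ → countLong-≤ k n 5 L x long⇒>L) ⟩
      matches
    ≤⟨ m≤n*m matches n ⟩
      n * matches
    ≤⟨ n*matches≤σ^n ⟩
      σ ^ n
    ≡⟨ sym (*-identityˡ (σ ^ n)) ⟩
      1 * σ ^ n ∎
    where open ≤-Reasoning

theorem3 : ∀ σ → 2 ≤ σ →
      (∃[ C ] ∃[ n₀ ] ∀ n → n₀ ≤ n → 3 ≤ n → ∀ k → 1 ≤ k → KBound n k →
         σ ^ sumMaxLcp σ n k ≤ n ^ (C * σ ^ n))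
    × (∃[ α ] ∃[ C ] ∃[ n₀ ] ∀ n → n₀ ≤ n → 3 ≤ n → ∀ k → 1 ≤ k → KBound n k →
         sumCount σ n k α ≤ C * σ ^ n)
theorem3 σ 2≤σ =
    (6 , n₀ , λ n n₀≤n _ k _ k-small → LongStrings.σ^sumMaxLcp-≤ 2≤σ n₀≤n k-small)
  , (5 , 1 , n₀ , λ n n₀≤n _ k _ k-small → LongStrings.sumCount-≤ 2≤σ n₀≤n k-small)
  where
  n₀ : ℕ
  n₀ = suc (2 ^ (6 * σ))
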